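{- Let $q$ be a prime power and $m$ an integer. For $n\le m$, a $(n\times m,\delta)_q$ MRD--code is a set $\mathcal A$ of $q^{n(m-\delta+1)}$ matrices in $\mathcal M_{n\times m}(q)$ (the $n\times m$ matrices over ${\rm GF}(q)$) such that $\mathrm{rank}(A-B)\ge \delta$ for all distinct $A,B\in\mathcal A$. For $A\in\mathcal M_{n\times m}(q)$, let $L(A)$ be the $(n-1)$--dimensional projective subspace of ${\rm PG}(n+m-1,q)$ spanned by the points whose coordinate vectors are the rows of the $n\times(n+m)$ matrix $(I_n\,|\,A)$. Let $U_i$ denote the point of ${\rm PG}(n+m-1,q)$ with $1$ in the $i$-th coordinate and $0$ elsewhere, and let $\Sigma=\langle U_{n+1},\dots,U_{n+m}\rangle$ (an $(m-1)$--dimensional subspace). Then: (i) If $\mathcal A$ is a $(3\times m,2)_q$ MRD--code with $m\ge 3$, then $\mathcal X=\{L(A)\mid A\in\mathcal A\}$ is a set of $q^{2m}$ planes of ${\rm PG}(m+2,q)$ such that every line of ${\rm PG}(m+2,q)$ disjoint from $\Sigma$ is contained in exactly one element of $\mathcal X$. (ii) If $\mathcal A$ is a $(4\times m,3)_q$ MRD--code with $m\ge 4$, then $\mathcal X=\{L(A)\mid A\in\mathcal A\}$ is a set of $q^{2m}$ solids (3--dimensional subspaces) of ${\rm PG}(m+3,q)$ such that every line of ${\rm PG}(m+3,q)$ disjoint from $\Sigma$ is contained in exactly one element of $\mathcal X$. (iii) If $\mathcal A$ is a $(4\times m,2)_q$ MRD--code with $m\ge 4$, then $\mathcal X=\{L(A)\mid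 A\in\mathcal A\}$ is a set of $q^{3m}$ solids of ${\rm PG}(m+3,q)$ such that every plane of ${\rm PG}(m+3,q)$ disjoint from $\Sigma$ is contained in exactly one element of $\mathcal X$.
   Context: Dimensions are projective dimensions; a solid is a 3--dimensional projective subspace. In case (i), $n=3$ and $\Sigma=\langle U_4,\dots,U_{m+3}\rangle$ in ${\rm PG}(m+2,q)$; in cases (ii),(iii), $n=4$ and $\Sigma=\langle U_5,\dots,U_{m+4}\rangle$ in ${\rm PG}(m+3,q)$. -}

module Defs where

open import Level using (0ℓ)
open import Data.Nat using (ℕ; zero; suc; _+_; _*_; _∸_; _^_; _≤_)
open import Data.Fin using (Fin; zero; suc; splitAt; _↑ʳ_)
import Data.Fin as Fin
open import Data.Sum using (_⊎_; inj₁; inj₂)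
open import Data.Product using (Σ; Σ-syntax; ∃; _×_; _,_)
open import Relation.Binary.PropositionalEquality using (_≡_; _≢_)
open import Relation.Nullary using (¬_; yes; no)
open import Algebra.Core using (Op₁; Op₂)
open import Algebra.Structures using (IsCommutativeRing)
open import Function.Bundles using (_↔_)
open import Function.Definitions using (Injective)

-- A finite field with exactly q elements (a model of GF(q); q is then
-- necessarily a prime power, and GF(q) is unique up to isomorphism).

record FiniteField (q : ℕ) : Set₁ where
  field
    Carrier           : Set
    _+F_ _*F_         : Op₂ Carrier
    -F_               : Op₁ Carrier
    0F 1F             : Carrier
    isCommutativeRing : IsCommutativeRing _≡_ _+F_ _*F_ -F_ 0F 1F
    0≢1               : 0F ≢ 1F
    inverse           : ∀ x → x ≢ 0F → Σ Carrier (λ y → x *F y ≡ 1F)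
    card              : Carrier ↔ Fin q

module LinAlg {q : ℕ} (F : FiniteField q) where
  open FiniteField F

  -- vectors of F^N (coordinate vectors of points of PG(N-1,q))
  Vect : ℕ → Set
  Vect N = Fin N → Carrier

  Matrix : ℕ → ℕ → Set
  Matrix n m = Fin n → Fin m → Carrier

  _-M_ : ∀ {n m} → Matrix n m → Matrix n m → Matrix n m
  (A -M B) i j = A i j +F (-F B i j)

  sumF : ∀ {d} → (Fin d → Carrier) → Carrier
  sumF {zero}  f = 0F
  sumF {suc d} f = f zero +F sumF (λ i → f (suc i))

  lincomb : ∀ {d N} → (Fin d → Carrier) → (Fin d → Vect N) → Vect N
  lincomb c v k = sumF (λ i → c i *F v i k)

  IsZero : ∀ {N} → Vect N → Set
  IsZero w = ∀ k → w k ≡ 0F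

  LinIndep : ∀ {d N} → (Fin d → Vect N) → Set
  LinIndep v = ∀ c → IsZero (lincomb c v) → ∀ i → c i ≡ 0F

  InSpan : ∀ {d N} → (Fin d → Vect N) → Vect N → Set
  InSpan v w = Σ[ c ∈ _ ] (∀ k → w k ≡ lincomb c v k)

  SpanSub : ∀ {d e N} → (Fin d → Vect N) → (Fin e → Vect N) → Set
  SpanSub v u = ∀ w → InSpan v w → InSpan u w

  SameSpan : ∀ {d e N} → (Fin d → Vect N) → (Fin e → Vect N) → Set
  SameSpan v u = SpanSub v u × SpanSub u v

  -- the (vector) subspaces spanned by v and u meet only in 0,
  -- i.e. the projective subspaces are disjoint
  DisjointSpans : ∀ {d e N} → (Fin d → Vect N) → (Fin e → Vect N) → Set
  DisjointSpans v u = ∀ w → InSpan v w → InSpan u w → IsZero w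

  RankAtLeast : ∀ {n m} → Matrix n m → ℕ → Set
  RankAtLeast {n} A d =
    Σ[ σ ∈ (Fin d → Fin n) ] (Injective _≡_ _≡_ σ × LinIndep (λ i → A (σ i)))

  record MRDCode (n m δ : ℕ) : Set where
    field
      code     : Fin (q ^ (m * (n + 1 ∸ δ))) → Matrix n m
      distance : ∀ i j → i ≢ j → RankAtLeast (code i -M code j) δ

  unit : ∀ {N} → Fin N → Vect N
  unit k l with k Fin.≟ l
  ... | yes _ = 1F
  ... | no  _ = 0F

  -- rows of (I_n | A): they span L(A) in PG(n+m-1,q)
  LRows : ∀ {n m} → Matrix n m → Fin n → Vect (n + m)
  LRows {n} A i k with splitAt n k
  ... | inj₁ j = unit i j
  ... | inj₂ j = A i j

  SigmaBasis : ∀ n m → Fin m → Vect (n + m)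
  SigmaBasis n m j = unit (n ↑ʳ j)

  -- The set X = { L(A) | A ∈ 𝒜 } has exactly M elements:
  -- there are M codewords whose L's are pairwise distinct subspaces and
  -- every L(A), A ∈ 𝒜, equals one of them.
  HasSizeX : ∀ {n m δ} → MRDCode n m δ → ℕ → Set
  HasSizeX {n} {m} {δ} 𝒜 M =
    Σ[ g ∈ (Fin M → Fin (q ^ (m * (n + 1 ∸ δ)))) ]
      ( (∀ i i' → i ≢ i' → ¬ SameSpan (LRows (code (g i))) (LRows (code (g i'))))
      × (∀ j → Σ[ i ∈ Fin M ] SameSpan (LRows (code j)) (LRows (code (g i)))) )
    where open MRDCode 𝒜

  -- Conclusion: X is a set of M subspaces of projective dimension n-1 of
  -- PG(n+m-1,q) such that every (t-1)-dimensional projective subspace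
  -- disjoint from Σ is contained in exactly one element of X.
  Conclusion : ∀ {n m δ} → MRDCode n m δ → ℕ → ℕ → Set
  Conclusion {n} {m} {δ} 𝒜 M t =
      (∀ j → LinIndep (LRows (code j)))
    × HasSizeX 𝒜 M
    × (∀ (B : Fin t → Vect (n + m)) → LinIndep B →
         DisjointSpans B (SigmaBasis n m) →
         Σ[ i ∈ _ ] ( SpanSub B (LRows (code i))
                    × (∀ j → SpanSub B (LRows (code j)) →
                         SameSpan (LRows (code j)) (LRows (code i)))))
    where open MRDCode 𝒜

module Submission where

-- Let 𝒜 be an (n × m, δ)_q MRD code with δ ≥ 1 and put
-- t = n + 1 - δ, so that |𝒜| = q^(m t).  A point w of PG(n+m-1,q) splits
-- as w = (front w | back w) ∈ F^n × F^m, and L(A) is the graph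
-- { (x | x · A) }.  A (t-1)-space ⟨B⟩ disjoint from Σ has t independent
-- fronts C = front B, and ⟨B⟩ ⊆ L(A) iff back B = C · A.  The map
-- A ↦ C · A is injective on 𝒜: if C · (A - A') = 0 with rank(A - A') ≥ δ,
-- the rows of C together with δ unit vectors picking independent rows of
-- A - A' would be t + δ = n + 1 independent vectors of F^n.  An injective
-- map from the q^(m t) codewords to the q^(m t) matrices t × m is onto,
-- which gives an element of X through ⟨B⟩; injectivity makes it unique.
-- Distinct codewords give distinct L(A), since rank(A - A') ≥ δ ≥ 1.

open import Defs
open import Data.Nat using (ℕ; _*_; _^_; _≤_)
open import Data.Product using (_×_)
open import Level using (0ℓ)
open import Data.Nat using (zero; suc; _+_; _∸_; _<_; s≤s)
open import Data.Nat.Properties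
  using (+-comm; *-comm; n<1+n; m≤n+m∸n; m≤n⇒m≤1+n; ^-*-assoc; <-irrefl; module ≤-Reasoning)
open import Data.Fin using (Fin; zero; suc; splitAt; _↑ˡ_; _↑ʳ_; punchIn; punchOut; cast; funToFin; finToFun)
import Data.Fin as Fin
import Data.Fin.Properties as FinProps
open import Data.Vec.Functional using (_++_; insertAt)
open import Data.Vec.Functional.Properties using (lookup-++ˡ; lookup-++ʳ; insertAt-lookup; insertAt-punchIn)
open import Data.Sum using (inj₁; inj₂)
open import Data.Product using (Σ-syntax; ∃; _,_; proj₁; proj₂)
open import Data.Empty using (⊥-elim)
open import Relation.Nullary using (¬_; yes; no; Dec)
open import Relation.Nullary.Decidable using (¬?; decidable-stable)
open import Relation.Binary.PropositionalEquality
open import Function using (_∘_; id)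
open import Function.Bundles using (Inverse)
open import Function.Definitions using (Injective)
open import Algebra.Bundles using (CommutativeRing)
import Algebra.Properties.Ring as RingProperties
import Algebra.Properties.Semiring.Sum as SemiringSum

injective⇒surjective : ∀ {N} (f : Fin N → Fin N) → Injective _≡_ _≡_ f →
                       ∀ y → ∃ λ x → f x ≡ y
injective⇒surjective {zero}  f inj ()
injective⇒surjective {suc N} f inj y with FinProps.any? (λ x → f x Fin.≟ y)
... | yes hit = hit
... | no miss = ⊥-elim (<-irrefl refl (FinProps.injective⇒≤ {f = g} g-injective))
  where
  -- if y is missed, f factors injectively through Fin N
  y≢f : ∀ x → y ≢ f x
  y≢f x e = miss (x , sym e)
  g : Fin (suc N) → Fin N
  g x = punchOut (y≢f x)
  g-injective : Injective _≡_ _≡_ g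
  g-injective e = inj (FinProps.punchOut-injective (y≢f _) (y≢f _) e)

funToFin-injective : ∀ {k r} (f g : Fin k → Fin r) → funToFin f ≡ funToFin g → f ≗ g
funToFin-injective f g e i = begin
  f i                        ≡⟨ FinProps.finToFun-funToFin f i ⟨
  finToFun (funToFin f) i    ≡⟨ cong (λ z → finToFun z i) e ⟩
  finToFun (funToFin g) i    ≡⟨ FinProps.finToFun-funToFin g i ⟩
  g i                        ∎
  where open ≡-Reasoning

cast-injective : ∀ {a b} .(eq : a ≡ b) (x y : Fin a) → cast eq x ≡ cast eq y → x ≡ y
cast-injective eq x y e = begin
  x                          ≡⟨ FinProps.cast-involutive (sym eq) eq x ⟨
  cast (sym eq) (cast eq x)  ≡⟨ cong (cast (sym eq)) e ⟩
  cast (sym eq) (cast eq y)  ≡⟨ FinProps.cast-involutive (sym eq) eq y ⟩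
  y                          ∎
  where open ≡-Reasoning

↑ʳ≢↑ˡ : ∀ {t s} (j : Fin s) (i : Fin t) → t ↑ʳ j ≢ i ↑ˡ s
↑ʳ≢↑ˡ {t} {s} j i e with trans (sym (FinProps.splitAt-↑ʳ t s j)) (trans (cong (splitAt t) e) (FinProps.splitAt-↑ˡ t i s))
... | ()

↑-cases : ∀ {t s} (P : Fin (t + s) → Set) →
          (∀ i → P (i ↑ˡ s)) → (∀ j → P (t ↑ʳ j)) → ∀ x → P x
↑-cases {t} P left right x with splitAt t x in eq
... | inj₁ i = subst P (FinProps.splitAt⁻¹-↑ˡ eq) (left i)
... | inj₂ j = subst P (FinProps.splitAt⁻¹-↑ʳ eq) (right j)

-- With t = n + 1 - d, t + d vectors of F^n are too many to be independent.
codimension-bound : ∀ n d → n < (n + 1 ∸ d) + d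
codimension-bound n d = begin-strict
  n                  <⟨ n<1+n n ⟩
  suc n              ≡⟨ +-comm 1 n ⟩
  n + 1              ≤⟨ m≤n+m∸n (n + 1) d ⟩
  d + (n + 1 ∸ d)    ≡⟨ +-comm d (n + 1 ∸ d) ⟩
  (n + 1 ∸ d) + d    ∎
  where open ≤-Reasoning

module FieldLinearAlgebra {q : ℕ} (F : FiniteField q) where
  open FiniteField F
  open LinAlg F

  ring : CommutativeRing 0ℓ 0ℓ
  ring = record { isCommutativeRing = isCommutativeRing }

  module R = CommutativeRing ring
  open RingProperties R.ring using (-‿distribˡ-*; x[y-z]≈xy-xz; -1*x≈-x)
  open SemiringSum R.semiring
    using (sum; sum-cong-≗; sum-replicate-zero; ∑-distrib-+; ∑-comm; *-distribˡ-sum; *-distribʳ-sum; sum-remove)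
  open ≡-Reasoning

  infixl 6 _−_
  _−_ : Carrier → Carrier → Carrier
  x − y = x +F (-F y)

  card-injective : ∀ {x y} → Inverse.to card x ≡ Inverse.to card y → x ≡ y
  card-injective {x} {y} e = begin
    x                                      ≡⟨ Inverse.strictlyInverseʳ card x ⟨
    Inverse.from card (Inverse.to card x)  ≡⟨ cong (Inverse.from card) e ⟩
    Inverse.from card (Inverse.to card y)  ≡⟨ Inverse.strictlyInverseʳ card y ⟩
    y                                      ∎

  _≟F_ : (x y : Carrier) → Dec (x ≡ y)
  x ≟F y with Inverse.to card x Fin.≟ Inverse.to card y
  ... | yes e = yes (card-injective e)
  ... | no ne = no (ne ∘ cong (Inverse.to card))

  1≢0 : 1F ≢ 0F
  1≢0 = 0≢1 ∘ sym

  sumF≡sum : ∀ {d} (f : Fin d → Carrier) → sumF f ≡ sum f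
  sumF≡sum {zero}  f = refl
  sumF≡sum {suc d} f = cong (f zero +F_) (sumF≡sum (f ∘ suc))

  sumF-cong : ∀ {d} {f g : Fin d → Carrier} → f ≗ g → sumF f ≡ sumF g
  sumF-cong {f = f} {g} f≗g = begin
    sumF f  ≡⟨ sumF≡sum f ⟩
    sum f   ≡⟨ sum-cong-≗ f≗g ⟩
    sum g   ≡⟨ sumF≡sum g ⟨
    sumF g  ∎

  sumF-zero : ∀ {d} {f : Fin d → Carrier} → (∀ i → f i ≡ 0F) → sumF f ≡ 0F
  sumF-zero {d} f≗0 = trans (sumF-cong f≗0) (trans (sumF≡sum {d} (λ _ → 0F)) (sum-replicate-zero d))

  sumF-+ : ∀ {d} (f g : Fin d → Carrier) → sumF (λ i → f i +F g i) ≡ sumF f +F sumF g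
  sumF-+ f g = begin
    sumF (λ i → f i +F g i)  ≡⟨ sumF≡sum (λ i → f i +F g i) ⟩
    sum (λ i → f i +F g i)   ≡⟨ ∑-distrib-+ f g ⟩
    sum f +F sum g           ≡⟨ cong₂ _+F_ (sumF≡sum f) (sumF≡sum g) ⟨
    sumF f +F sumF g         ∎

  sumF-*ˡ : ∀ {d} a (f : Fin d → Carrier) → a *F sumF f ≡ sumF (λ i → a *F f i)
  sumF-*ˡ a f = begin
    a *F sumF f               ≡⟨ cong (a *F_) (sumF≡sum f) ⟩
    a *F sum f                ≡⟨ *-distribˡ-sum a f ⟩
    sum (λ i → a *F f i)      ≡⟨ sumF≡sum (λ i → a *F f i) ⟨
    sumF (λ i → a *F f i)     ∎

  sumF-*ʳ : ∀ {d} a (f : Fin d → Carrier) → sumF f *F a ≡ sumF (λ i → f i *F a)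
  sumF-*ʳ a f = begin
    sumF f *F a               ≡⟨ cong (_*F a) (sumF≡sum f) ⟩
    sum f *F a                ≡⟨ *-distribʳ-sum a f ⟩
    sum (λ i → f i *F a)      ≡⟨ sumF≡sum (λ i → f i *F a) ⟨
    sumF (λ i → f i *F a)     ∎

  sumF-neg : ∀ {d} (f : Fin d → Carrier) → -F sumF f ≡ sumF (λ i → -F f i)
  sumF-neg f = begin
    -F sumF f                     ≡⟨ -1*x≈-x (sumF f) ⟨
    (-F 1F) *F sumF f             ≡⟨ sumF-*ˡ (-F 1F) f ⟩
    sumF (λ i → (-F 1F) *F f i)   ≡⟨ sumF-cong (λ i → -1*x≈-x (f i)) ⟩
    sumF (λ i → -F f i)           ∎

  sumF-− : ∀ {d} (f g : Fin d → Carrier) → sumF (λ i → f i − g i) ≡ sumF f − sumF g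
  sumF-− f g = trans (sumF-+ f (λ i → -F g i)) (cong (sumF f +F_) (sym (sumF-neg g)))

  sumF-comm : ∀ {d e} (f : Fin d → Fin e → Carrier) →
              sumF (λ i → sumF (f i)) ≡ sumF (λ j → sumF (λ i → f i j))
  sumF-comm f = begin
    sumF (λ i → sumF (f i))               ≡⟨ sumF-cong (λ i → sumF≡sum (f i)) ⟩
    sumF (λ i → sum (f i))                ≡⟨ sumF≡sum (λ i → sum (f i)) ⟩
    sum (λ i → sum (f i))                 ≡⟨ ∑-comm f ⟩
    sum (λ j → sum (λ i → f i j))         ≡⟨ sumF≡sum (λ j → sum (λ i → f i j)) ⟨
    sumF (λ j → sum (λ i → f i j))        ≡⟨ sumF-cong (λ j → sumF≡sum (λ i → f i j)) ⟨
    sumF (λ j → sumF (λ i → f i j))       ∎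

  sumF-remove : ∀ {d} (f : Fin (suc d) → Carrier) p →
                sumF f ≡ f p +F sumF (f ∘ punchIn p)
  sumF-remove f p = begin
    sumF f                        ≡⟨ sumF≡sum f ⟩
    sum f                         ≡⟨ sum-remove {i = p} f ⟩
    f p +F sum (f ∘ punchIn p)    ≡⟨ cong (f p +F_) (sumF≡sum (f ∘ punchIn p)) ⟨
    f p +F sumF (f ∘ punchIn p)   ∎

  sumF-single : ∀ {d} (f : Fin d → Carrier) p → (∀ i → i ≢ p → f i ≡ 0F) → sumF f ≡ f p
  sumF-single {suc d} f p others = begin
    sumF f                         ≡⟨ sumF-remove f p ⟩
    f p +F sumF (f ∘ punchIn p)    ≡⟨ cong (f p +F_) (sumF-zero (λ i → others _ (FinProps.punchInᵢ≢i p i))) ⟩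
    f p +F 0F                      ≡⟨ R.+-identityʳ (f p) ⟩
    f p                            ∎

  sumF-split : ∀ t {s} (f : Fin (t + s) → Carrier) →
               sumF f ≡ sumF (λ i → f (i ↑ˡ s)) +F sumF (λ j → f (t ↑ʳ j))
  sumF-split zero    f = sym (R.+-identityˡ (sumF f))
  sumF-split (suc t) f =
    trans (cong (f zero +F_) (sumF-split t (f ∘ suc))) (sym (R.+-assoc (f zero) _ _))

  unit-same : ∀ {N} (i : Fin N) → unit i i ≡ 1F
  unit-same i with i Fin.≟ i
  ... | yes _  = refl
  ... | no i≢i = ⊥-elim (i≢i refl)

  unit-diff : ∀ {N} {i j : Fin N} → i ≢ j → unit i j ≡ 0F
  unit-diff {i = i} {j} i≢j with i Fin.≟ j
  ... | yes i≡j = ⊥-elim (i≢j i≡j)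
  ... | no _    = refl

  -- Note that 'lincomb c A' is also the row vector c times the matrix A.

  lincomb-unit : ∀ {d N} (i : Fin d) (v : Fin d → Vect N) → lincomb (unit i) v ≗ v i
  lincomb-unit i v k = begin
    sumF (λ j → unit i j *F v j k)  ≡⟨ sumF-single _ i (λ j j≢i → trans (cong (_*F v j k) (unit-diff (j≢i ∘ sym))) (R.zeroˡ _)) ⟩
    unit i i *F v i k               ≡⟨ cong (_*F v i k) (unit-same i) ⟩
    1F *F v i k                     ≡⟨ R.*-identityˡ (v i k) ⟩
    v i k                           ∎

  lincomb-units : ∀ {d N} (ι : Fin d → Fin N) → Injective _≡_ _≡_ ι →
                  ∀ c j → lincomb c (unit ∘ ι) (ι j) ≡ c j
  lincomb-units ι ι-injective c j = begin
    sumF (λ i → c i *F unit (ι i) (ι j))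
      ≡⟨ sumF-single _ j (λ i i≢j → trans (cong (c i *F_) (unit-diff (i≢j ∘ ι-injective))) (R.zeroʳ _)) ⟩
    c j *F unit (ι j) (ι j)   ≡⟨ cong (c j *F_) (unit-same (ι j)) ⟩
    c j *F 1F                 ≡⟨ R.*-identityʳ (c j) ⟩
    c j                       ∎

  lincomb-units-outside : ∀ {d N} (ι : Fin d → Fin N) c k → (∀ i → ι i ≢ k) →
                          lincomb c (unit ∘ ι) k ≡ 0F
  lincomb-units-outside ι c k outside =
    sumF-zero (λ i → trans (cong (c i *F_) (unit-diff (outside i))) (R.zeroʳ (c i)))

  lincomb-assoc : ∀ {d e N} (a : Fin d → Carrier) (C : Fin d → Vect e) (M : Fin e → Vect N) →
                  lincomb a (λ i → lincomb (C i) M) ≗ lincomb (lincomb a C) M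
  lincomb-assoc a C M l = begin
    sumF (λ i → a i *F sumF (λ k → C i k *F M k l))   ≡⟨ sumF-cong (λ i → sumF-*ˡ (a i) (λ k → C i k *F M k l)) ⟩
    sumF (λ i → sumF (λ k → a i *F (C i k *F M k l))) ≡⟨ sumF-comm (λ i k → a i *F (C i k *F M k l)) ⟩
    sumF (λ k → sumF (λ i → a i *F (C i k *F M k l))) ≡⟨ sumF-cong (λ k → sumF-cong (λ i → sym (R.*-assoc (a i) (C i k) (M k l)))) ⟩
    sumF (λ k → sumF (λ i → (a i *F C i k) *F M k l)) ≡⟨ sumF-cong (λ k → sumF-*ʳ (M k l) (λ i → a i *F C i k)) ⟨
    sumF (λ k → sumF (λ i → a i *F C i k) *F M k l)   ∎

  lincomb-+ : ∀ {d N} (a b : Fin d → Carrier) (v : Fin d → Vect N) →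
              lincomb (λ i → a i +F b i) v ≗ λ k → lincomb a v k +F lincomb b v k
  lincomb-+ a b v k = trans (sumF-cong (λ i → R.distribʳ (v i k) (a i) (b i)))
    (sumF-+ (λ i → a i *F v i k) (λ i → b i *F v i k))

  lincomb-−ᴹ : ∀ {d N} (c : Fin d → Carrier) (A B : Matrix d N) →
               lincomb c (A -M B) ≗ λ l → lincomb c A l − lincomb c B l
  lincomb-−ᴹ c A B l = trans (sumF-cong (λ k → x[y-z]≈xy-xz (c k) (A k l) (B k l)))
    (sumF-− (λ k → c k *F A k l) (λ k → c k *F B k l))

  lincomb-++ : ∀ {t s N} (c : Fin (t + s) → Carrier) (C : Fin t → Vect N) (E : Fin s → Vect N) →
               lincomb c (C ++ E) ≗ λ k → lincomb (c ∘ (_↑ˡ s)) C k +F lincomb (c ∘ (t ↑ʳ_)) E k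
  lincomb-++ {t} c C E k = trans (sumF-split t _)
    (cong₂ _+F_ (sumF-cong (λ i → cong (λ u → c (i ↑ˡ _) *F u k) (lookup-++ˡ C E i)))
                (sumF-cong (λ j → cong (λ u → c (t ↑ʳ j) *F u k) (lookup-++ʳ C E j))))

  lincomb-zeroˡ : ∀ {d N} (c : Fin d → Carrier) (v : Fin d → Vect N) → (∀ i → c i ≡ 0F) → IsZero (lincomb c v)
  lincomb-zeroˡ c v c≡0 k = sumF-zero (λ i → trans (cong (_*F v i k) (c≡0 i)) (R.zeroˡ _))

  lincomb-zeroʳ : ∀ {d N} (c : Fin d → Carrier) (v : Fin d → Vect N) → (∀ i → IsZero (v i)) → IsZero (lincomb c v)
  lincomb-zeroʳ c v v≡0 k = sumF-zero (λ i → trans (cong (c i *F_) (v≡0 i k)) (R.zeroʳ (c i)))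

  InSpan-member : ∀ {d N} (v : Fin d → Vect N) i → InSpan v (v i)
  InSpan-member v i = unit i , λ k → sym (lincomb-unit i v k)

  SameSpan-refl : ∀ {d N} (v : Fin d → Vect N) → SameSpan v v
  SameSpan-refl v = (λ _ w∈v → w∈v) , (λ _ w∈v → w∈v)

  LinDep : ∀ {d N} → (Fin d → Vect N) → Set
  LinDep {d} v = Σ[ c ∈ (Fin d → Carrier) ] (IsZero (lincomb c v) × ∃ λ i → c i ≢ 0F)

  LinDep⇒¬LinIndep : ∀ {d N} {v : Fin d → Vect N} → LinDep v → ¬ LinIndep v
  LinDep⇒¬LinIndep (c , relation , i , cᵢ≢0) independent = cᵢ≢0 (independent c relation i)

  relation-from-tails : ∀ {d N} (v : Fin d → Vect (suc N)) → (∀ i → v i zero ≡ 0F) →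
                        ∀ c → IsZero (lincomb c (λ i → v i ∘ suc)) → IsZero (lincomb c v)
  relation-from-tails v v₀≡0 c relation zero    =
    sumF-zero (λ i → trans (cong (c i *F_) (v₀≡0 i)) (R.zeroʳ (c i)))
  relation-from-tails v v₀≡0 c relation (suc l) = relation l

  -- Gaussian elimination step: subtracting r i times the vector v p from
  -- the others transforms a relation c among the new vectors into the
  -- relation (c with -Σ c i r i inserted at p) among the old ones.
  shear-relation : ∀ {d N} (v : Fin (suc d) → Vect N) (p : Fin (suc d)) (r c : Fin d → Carrier) →
    lincomb (insertAt c p (-F sumF (λ i → c i *F r i))) v
      ≗ lincomb c (λ i l → v (punchIn p i) l − r i *F v p l)
  shear-relation v p r c l = begin
    sumF (λ x → c⁺ x *F v x l)
      ≡⟨ sumF-remove (λ x → c⁺ x *F v x l) p ⟩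
    (c⁺ p *F v p l) +F sumF (λ i → c⁺ (punchIn p i) *F v (punchIn p i) l)
      ≡⟨ cong₂ _+F_ (cong (_*F v p l) (insertAt-lookup c p s))
                    (sumF-cong (λ i → cong (_*F v (punchIn p i) l) (insertAt-punchIn c p s i))) ⟩
    (s *F v p l) +F sumF (λ i → c i *F v (punchIn p i) l)
      ≡⟨ cong (_+F sumF (λ i → c i *F v (punchIn p i) l)) (-‿distribˡ-* cr (v p l)) ⟨
    (-F (cr *F v p l)) +F sumF (λ i → c i *F v (punchIn p i) l)
      ≡⟨ R.+-comm _ _ ⟩
    sumF (λ i → c i *F v (punchIn p i) l) − cr *F v p l
      ≡⟨ cong (sumF (λ i → c i *F v (punchIn p i) l) −_) (sumF-*ʳ (v p l) (λ i → c i *F r i)) ⟩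
    sumF (λ i → c i *F v (punchIn p i) l) − sumF (λ i → (c i *F r i) *F v p l)
      ≡⟨ sumF-− (λ i → c i *F v (punchIn p i) l) (λ i → (c i *F r i) *F v p l) ⟨
    sumF (λ i → c i *F v (punchIn p i) l − (c i *F r i) *F v p l)
      ≡⟨ sumF-cong (λ i → trans (cong (λ u → c i *F v (punchIn p i) l − u) (R.*-assoc (c i) (r i) (v p l)))
                                (sym (x[y-z]≈xy-xz (c i) _ _))) ⟩
    sumF (λ i → c i *F (v (punchIn p i) l − r i *F v p l))
      ∎
    where
    cr = sumF (λ i → c i *F r i)
    s  = -F cr
    c⁺ = insertAt c p s

  dependent : ∀ {k d} → k < d → (v : Fin d → Vect k) → LinDep v
  dependent {zero}  {suc d} _ v = (λ _ → 1F) , (λ ()) , zero , 1≢0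
  dependent {suc k} {suc d} (s≤s k<d) v with FinProps.any? (λ i → ¬? (v i zero ≟F 0F))
  ... | no noPivot =
    let c , relation , i , cᵢ≢0 = dependent (m≤n⇒m≤1+n k<d) (λ i → v i ∘ suc)
    in c , relation-from-tails v v₀≡0 c relation , i , cᵢ≢0
    where
    v₀≡0 : ∀ i → v i zero ≡ 0F
    v₀≡0 i = decidable-stable (v i zero ≟F 0F) (λ v₀≢0 → noPivot (i , v₀≢0))
  ... | yes (p , pivot≢0) =
    let c , relation , i , cᵢ≢0 = dependent k<d (λ i → w i ∘ suc)
    in insertAt c p _
     , (λ l → trans (shear-relation v p r c l) (relation-from-tails w w₀≡0 c relation l))
     , punchIn p i
     , (λ c≡0 → cᵢ≢0 (trans (sym (insertAt-punchIn c p _ i)) c≡0))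
    where
    pivot⁻¹ = proj₁ (inverse (v p zero) pivot≢0)
    r : Fin d → Carrier
    r i = v (punchIn p i) zero *F pivot⁻¹
    w : Fin d → Vect (suc k)
    w i l = v (punchIn p i) l − r i *F v p l
    w₀≡0 : ∀ i → w i zero ≡ 0F
    w₀≡0 i = begin
      x − (x *F pivot⁻¹) *F v p zero   ≡⟨ cong (λ u → x − u) (R.*-assoc x pivot⁻¹ (v p zero)) ⟩
      x − x *F (pivot⁻¹ *F v p zero)   ≡⟨ cong (λ u → x − x *F u) (R.*-comm pivot⁻¹ (v p zero)) ⟩
      x − x *F (v p zero *F pivot⁻¹)   ≡⟨ cong (λ u → x − x *F u) (proj₂ (inverse (v p zero) pivot≢0)) ⟩
      x − x *F 1F                      ≡⟨ cong (λ u → x − u) (R.*-identityʳ x) ⟩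
      x − x                            ≡⟨ R.-‿inverseʳ x ⟩
      0F                               ∎
      where x = v (punchIn p i) zero

  rank-of-zero : ∀ {n m δ} (M : Matrix n m) → (∀ i j → M i j ≡ 0F) → ¬ RankAtLeast M (suc δ)
  rank-of-zero M M≡0 (σ , _ , independent) =
    1≢0 (independent (λ _ → 1F) (lincomb-zeroʳ (λ _ → 1F) (M ∘ σ) (λ j → M≡0 (σ j))) zero)

  -- Let the rows of C be independent with C · M = 0, and let the rows σ of
  -- M be independent.  Then the rows of C together with the unit vectors
  -- e_σ(j) are independent: multiplying a relation a·C + b·e_σ = 0 by M
  -- kills a·C and leaves b · (rows σ of M) = 0.
  independent-extension : ∀ {t n m δ} (C : Fin t → Vect n) (M : Matrix n m) (σ : Fin δ → Fin n) →
    LinIndep C → LinIndep (M ∘ σ) → (∀ i → IsZero (lincomb (C i) M)) →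
    LinIndep (C ++ (unit ∘ σ))
  independent-extension {t} {δ = δ} C M σ indC indM CM c relation =
    ↑-cases (λ x → c x ≡ 0F) (indC a aC≡0) b≡0
    where
    a = c ∘ (_↑ˡ δ)
    b = c ∘ (t ↑ʳ_)
    E = unit ∘ σ
    aC+bE≡0 : ∀ k → lincomb a C k +F lincomb b E k ≡ 0F
    aC+bE≡0 k = trans (sym (lincomb-++ c C E k)) (relation k)
    aCM≡0 : IsZero (lincomb (lincomb a C) M)
    aCM≡0 l = trans (sym (lincomb-assoc a C M l)) (lincomb-zeroʳ a _ CM l)
    bMσ≡0 : IsZero (lincomb b (M ∘ σ))
    bMσ≡0 l = begin
      lincomb b (M ∘ σ) l
        ≡⟨ sumF-cong (λ j → cong (b j *F_) (lincomb-unit (σ j) M l)) ⟨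
      lincomb b (λ j → lincomb (E j) M) l
        ≡⟨ lincomb-assoc b E M l ⟩
      lincomb (lincomb b E) M l
        ≡⟨ R.+-identityʳ _ ⟨
      lincomb (lincomb b E) M l +F 0F
        ≡⟨ cong (lincomb (lincomb b E) M l +F_) (aCM≡0 l) ⟨
      lincomb (lincomb b E) M l +F lincomb (lincomb a C) M l
        ≡⟨ lincomb-+ (lincomb b E) (lincomb a C) M l ⟨
      lincomb (λ k → lincomb b E k +F lincomb a C k) M l
        ≡⟨ lincomb-zeroˡ _ M (λ k → trans (R.+-comm _ _) (aC+bE≡0 k)) l ⟩
      0F ∎
    b≡0 : ∀ j → b j ≡ 0F
    b≡0 = indM b bMσ≡0
    aC≡0 : IsZero (lincomb a C)
    aC≡0 k = begin
      lincomb a C k                        ≡⟨ R.+-identityʳ _ ⟨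
      lincomb a C k +F 0F                  ≡⟨ cong (lincomb a C k +F_) (lincomb-zeroˡ b E b≡0 k) ⟨
      lincomb a C k +F lincomb b E k       ≡⟨ aC+bE≡0 k ⟩
      0F                                   ∎

  annihilator-bound : ∀ {t n m δ} (C : Fin t → Vect n) (M : Matrix n m) → n < t + δ →
    LinIndep C → RankAtLeast M δ → ¬ (∀ i → IsZero (lincomb (C i) M))
  annihilator-bound C M n<t+δ indC (σ , _ , indM) CM =
    LinDep⇒¬LinIndep (dependent n<t+δ (C ++ (unit ∘ σ))) (independent-extension C M σ indC indM CM)

  encode : ∀ {t m} → Matrix t m → Fin (q ^ (m * t))
  encode {t} {m} A =
    cast (^-*-assoc q m t) (funToFin (λ i → funToFin (λ j → Inverse.to card (A i j))))

  encode-injective : ∀ {t m} (A B : Matrix t m) → encode A ≡ encode B → ∀ i j → A i j ≡ B i j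
  encode-injective {t} {m} A B e i j =
    card-injective (funToFin-injective _ _ (funToFin-injective _ _ (cast-injective (^-*-assoc q m t) _ _ e) i) j)

  onto-matrices : ∀ {t m} (φ : Fin (q ^ (m * t)) → Matrix t m) →
    (∀ x y → (∀ i j → φ x i j ≡ φ y i j) → x ≡ y) →
    ∀ D → ∃ λ x → ∀ i j → φ x i j ≡ D i j
  onto-matrices φ φ-injective D =
    let x , e = injective⇒surjective (encode ∘ φ) (λ e → φ-injective _ _ (encode-injective _ _ e)) (encode D)
    in x , encode-injective _ _ e

  -- Points of PG(n+m-1,q) have coordinates (front w | back w) ∈ F^n × F^m,
  -- and L(A) = ⟨rows of (I | A)⟩ is the graph { (x | x · A) }.
  module Graph (n m : ℕ) where

    front : Vect (n + m) → Vect n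
    front w i = w (i ↑ˡ m)

    back : Vect (n + m) → Vect m
    back w j = w (n ↑ʳ j)

    LRows-front : ∀ (A : Matrix n m) i → front (LRows A i) ≗ unit i
    LRows-front A i j rewrite FinProps.splitAt-↑ˡ n j m = refl

    LRows-back : ∀ (A : Matrix n m) i → back (LRows A i) ≗ A i
    LRows-back A i j rewrite FinProps.splitAt-↑ʳ n m j = refl

    front-lincomb-LRows : ∀ (A : Matrix n m) c → front (lincomb c (LRows A)) ≗ c
    front-lincomb-LRows A c i =
      trans (sumF-cong (λ i' → cong (c i' *F_) (LRows-front A i' i))) (lincomb-units id id c i)

    back-lincomb-LRows : ∀ (A : Matrix n m) c → back (lincomb c (LRows A)) ≗ lincomb c A
    back-lincomb-LRows A c j = sumF-cong (λ i → cong (c i *F_) (LRows-back A i j))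

    LRows-independent : ∀ (A : Matrix n m) → LinIndep (LRows A)
    LRows-independent A c relation i = trans (sym (front-lincomb-LRows A c i)) (relation (i ↑ˡ m))

    ∈L⇒graph : ∀ (A : Matrix n m) w → InSpan (LRows A) w → back w ≗ lincomb (front w) A
    ∈L⇒graph A w (c , w≡cL) j = begin
      w (n ↑ʳ j)                      ≡⟨ w≡cL (n ↑ʳ j) ⟩
      lincomb c (LRows A) (n ↑ʳ j)    ≡⟨ back-lincomb-LRows A c j ⟩
      lincomb c A j                   ≡⟨ sumF-cong (λ i → cong (_*F A i j) (front≡c i)) ⟨
      lincomb (front w) A j           ∎
      where
      front≡c : front w ≗ c
      front≡c i = trans (w≡cL (i ↑ˡ m)) (front-lincomb-LRows A c i)

    graph⇒∈L : ∀ (A : Matrix n m) w → back w ≗ lincomb (front w) A → InSpan (LRows A) w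
    graph⇒∈L A w graph =
      front w , ↑-cases (λ k → w k ≡ lincomb (front w) (LRows A) k)
        (λ i → sym (front-lincomb-LRows A (front w) i))
        (λ j → trans (graph j) (sym (back-lincomb-LRows A (front w) j)))

    ⊆L⇒graph : ∀ {t} (B : Fin t → Vect (n + m)) (A : Matrix n m) → SpanSub B (LRows A) →
               ∀ i → back (B i) ≗ lincomb (front (B i)) A
    ⊆L⇒graph B A B⊆L i = ∈L⇒graph A (B i) (B⊆L (B i) (InSpan-member B i))

    graph⇒⊆L : ∀ {t} (B : Fin t → Vect (n + m)) (A : Matrix n m) →
               (∀ i → back (B i) ≗ lincomb (front (B i)) A) → SpanSub B (LRows A)
    graph⇒⊆L B A graphs w (c , w≡cB) = graph⇒∈L A w λ j → begin
      w (n ↑ʳ j)                                    ≡⟨ w≡cB (n ↑ʳ j) ⟩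
      lincomb c B (n ↑ʳ j)                          ≡⟨ sumF-cong (λ i → cong (c i *F_) (graphs i j)) ⟩
      lincomb c (λ i → lincomb (front (B i)) A) j   ≡⟨ lincomb-assoc c (front ∘ B) A j ⟩
      lincomb (lincomb c (front ∘ B)) A j           ≡⟨ sumF-cong (λ k → cong (_*F A k j) (w≡cB (k ↑ˡ m))) ⟨
      lincomb (front w) A j                         ∎

    L-injective : ∀ (A A' : Matrix n m) → SpanSub (LRows A) (LRows A') → ∀ i j → A i j ≡ A' i j
    L-injective A A' L⊆L' i j = begin
      A i j                              ≡⟨ LRows-back A i j ⟨
      back (LRows A i) j                 ≡⟨ ⊆L⇒graph (LRows A) A' L⊆L' i j ⟩
      lincomb (front (LRows A i)) A' j   ≡⟨ sumF-cong (λ k → cong (_*F A' k j) (LRows-front A i k)) ⟩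
      lincomb (unit i) A' j              ≡⟨ lincomb-unit i A' j ⟩
      A' i j                             ∎

    -- If ⟨B⟩ is disjoint from Σ, the fronts of independent vectors B are
    -- independent: a relation among the fronts gives a point of ⟨B⟩ ∩ Σ.
    front-independent : ∀ {t} (B : Fin t → Vect (n + m)) → LinIndep B →
                        DisjointSpans B (SigmaBasis n m) → LinIndep (front ∘ B)
    front-independent B indB disjoint c relation =
      indB c (disjoint w (c , λ _ → refl) (back w , w∈Σ))
      where
      w = lincomb c B
      w∈Σ : ∀ k → w k ≡ lincomb (back w) (SigmaBasis n m) k
      w∈Σ = ↑-cases (λ k → w k ≡ lincomb (back w) (SigmaBasis n m) k)
        (λ i → trans (relation i) (sym (lincomb-units-outside (n ↑ʳ_) (back w) (i ↑ˡ m) (λ j → ↑ʳ≢↑ˡ j i))))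
        (λ j → sym (lincomb-units (n ↑ʳ_) (FinProps.↑ʳ-injective n _ _) (back w) j))

  module MRDCover {n m δ : ℕ} (𝒜 : MRDCode n m (suc δ)) where
    open MRDCode 𝒜
    open Graph n m

    t : ℕ
    t = n + 1 ∸ suc δ

    L-distinct : ∀ x y → SpanSub (LRows (code x)) (LRows (code y)) → x ≡ y
    L-distinct x y Lx⊆Ly with x Fin.≟ y
    ... | yes x≡y = x≡y
    ... | no x≢y  = ⊥-elim (rank-of-zero (code x -M code y) difference≡0 (distance x y x≢y))
      where
      difference≡0 : ∀ i j → code x i j − code y i j ≡ 0F
      difference≡0 i j = trans (cong (_− code y i j) (L-injective _ _ Lx⊆Ly i j)) (R.-‿inverseʳ _)

    -- For t independent vectors C of F^n, the map A ↦ C · A is injective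
    -- on 𝒜, since rank (A - A') ≥ δ + 1 > n - t.
    projection-injective : (C : Fin t → Vect n) → LinIndep C →
      ∀ x y → (∀ i j → lincomb (C i) (code x) j ≡ lincomb (C i) (code y) j) → x ≡ y
    projection-injective C indC x y CAx≡CAy with x Fin.≟ y
    ... | yes x≡y = x≡y
    ... | no x≢y  = ⊥-elim (annihilator-bound C (code x -M code y) (codimension-bound n (suc δ)) indC (distance x y x≢y)
        (λ i l → trans (lincomb-−ᴹ (C i) (code x) (code y) l)
                       (trans (cong (_− lincomb (C i) (code y) l) (CAx≡CAy i l)) (R.-‿inverseʳ _))))

    -- Every (t-1)-space ⟨B⟩ disjoint from Σ lies in L(A) for exactly one A:
    -- A is the unique codeword with front B · A = back B.
    unique-cover : ∀ (B : Fin t → Vect (n + m)) → LinIndep B → DisjointSpans B (SigmaBasis n m) →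
      Σ[ x ∈ _ ] ( SpanSub B (LRows (code x))
                 × (∀ y → SpanSub B (LRows (code y)) → SameSpan (LRows (code y)) (LRows (code x))))
    unique-cover B indB disjoint = x , graph⇒⊆L B (code x) (λ i j → sym (Cx≡back i j)) , uniqueness
      where
      C = front ∘ B
      C-injective = projection-injective C (front-independent B indB disjoint)
      hit = onto-matrices (λ x i j → lincomb (C i) (code x) j) C-injective (back ∘ B)
      x = proj₁ hit
      Cx≡back = proj₂ hit
      uniqueness : ∀ y → SpanSub B (LRows (code y)) → SameSpan (LRows (code y)) (LRows (code x))
      uniqueness y B⊆Ly with C-injective y x (λ i j → trans (sym (⊆L⇒graph B (code y) B⊆Ly i j)) (sym (Cx≡back i j)))
      ... | refl = SameSpan-refl (LRows (code x))

    mrd-cover : Conclusion 𝒜 (q ^ (m * t)) t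
    mrd-cover =
        (λ x → LRows-independent (code x))
      , (id , (λ x y x≢y Lx=Ly → x≢y (L-distinct x y (proj₁ Lx=Ly))) , (λ x → x , SameSpan-refl _))
      , unique-cover

proposition2p1 : (q : ℕ) (F : FiniteField q) (m : ℕ) →
    let open LinAlg F in
      (3 ≤ m → (𝒜 : MRDCode 3 m 2) → Conclusion 𝒜 (q ^ (2 * m)) 2)
    × (4 ≤ m → (𝒜 : MRDCode 4 m 3) → Conclusion 𝒜 (q ^ (2 * m)) 2)
    × (4 ≤ m → (𝒜 : MRDCode 4 m 2) → Conclusion 𝒜 (q ^ (3 * m)) 3)
proposition2p1 q F m =
    (λ _ 𝒜 → resize 2 𝒜 (MRDCover.mrd-cover 𝒜))
  , (λ _ 𝒜 → resize 2 𝒜 (MRDCover.mrd-cover 𝒜))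
  , (λ _ 𝒜 → resize 3 𝒜 (MRDCover.mrd-cover 𝒜))
  where
  open FieldLinearAlgebra F
  open LinAlg F
  resize : ∀ {n δ} t (𝒜 : MRDCode n m δ) → Conclusion 𝒜 (q ^ (m * t)) t → Conclusion 𝒜 (q ^ (t * m)) t
  resize t 𝒜 = subst (λ M → Conclusion 𝒜 M t) (cong (q ^_) (*-comm m t))
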